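{- Let $k\geq 2$, let $I$ be a finite nonempty set of coordinates, and let $R = X_1\times \dots\times X_{k}\subseteq (\{0,1\}^{I})^{k}$ be a rectangle. If there is a coordinate $i\in I$ such that $R\cap D_{i}^{I} = \emptyset$, then there is some $j\in[k]$ such that \[ E^{I\setminus \{i\}}(\Pi_{i,j}(R)) \geq E^{I}(R) + 1/k. \]
   Context: For a set $I$: $D_{0}^{I}:=\{(x_1,\dots,x_k)\in(\{0,1\}^{I})^{k}: \forall i\in I,\ x_{1}(i) + \dots + x_{k}(i)\leq 1 \}$, and for $i\in I$, $D_{i}^I:=\{(x_1,\dots,x_k)\in(\{0,1\}^{I})^{k}: x_{1}(i) = \cdots =x_{k}(i)=1\text{ and } \forall i'\in I\setminus\{i\},\ x_{1}(i') + \dots + x_{k}(i')\leq 1 \}$. The density of a rectangle $R\subseteq(\{0,1\}^I)^k$ is $E^{I}(R):=\log_2\left(\frac{|R\cap D^I_{0}|}{(k+1)^{|I|}}\right)$ (with $\log 0=-\infty$). For $i\in I$ and $j\in[k]$, the projection $\Pi_{i,j}(R) =X_{1}'\times\cdots\times X_{k}'\subseteq(\{0,1\}^{I\setminus\{i\}})^{k}$ is defined by: for $j'\neq j$, $X_{j'}':=\{x'\in \{0,1\}^{I\setminus \{i\}}: (x',0)\in X_{j'}\}$; and $X_{j}':=\{x'\in \{0,1\}^{I\setminus \{i\}}: (x',0)\in X_{j}\text{ or } (x',1)\in X_{j}\}$, where $(x',b)\in\{0,1\}^I$ denotes the extension of $x'$ by setting coordinate $i$ to $b$. -}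

module Defs where

open import Data.Bool using (Bool; true; false; if_then_else_; _∧_; _∨_; not)
open import Data.Nat using (ℕ; zero; suc; _+_; _*_; _^_; _≤_; _≤ᵇ_)
open import Data.Fin using (Fin; zero; suc; punchIn)
open import Data.Fin.Properties using (_≟_)
open import Data.List using (List; []; _∷_; concatMap; map)
open import Data.Vec using (Vec; []; _∷_; lookup; insertAt; allFin; foldr)
import Data.Vec as V
open import Relation.Nullary.Decidable using (⌊_⌋)

-- Coordinate set I = Fin m (a finite set; nonempty means m = suc n).  A subset of {0,1}^I is given by its
-- (Boolean) indicator function; since {0,1}^I is finite this is fully general.
Point : ℕ → Set
Point m = Vec Bool m

Subset : ℕ → Set
Subset m = Point m → Bool

Rect : ℕ → ℕ → Set
Rect k m = Vec (Subset m) k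

Tuple : ℕ → ℕ → Set
Tuple k m = Vec (Point m) k

inRect : ∀ {k m} → Rect k m → Tuple k m → Bool
inRect [] [] = true
inRect (X ∷ Xs) (x ∷ xs) = X x ∧ inRect Xs xs

colSum : ∀ {k m} → Tuple k m → Fin m → ℕ
colSum xs c = foldr _ (λ x s → (if lookup x c then 1 else 0) + s) 0 xs

allB : ∀ {m} → (Fin m → Bool) → Bool
allB {m} p = foldr _ (λ c b → p c ∧ b) true (allFin m)

inD0 : ∀ {k m} → Tuple k m → Bool
inD0 xs = allB (λ c → colSum xs c ≤ᵇ 1)

inDi : ∀ {k m} → Fin m → Tuple k m → Bool
inDi {k} i xs =
  allB (λ c → if ⌊ c ≟ i ⌋ then ⌊ colSum xs c Data.Nat.≟ k ⌋ else (colSum xs c ≤ᵇ 1))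
  where import Data.Nat

allPoints : (m : ℕ) → List (Point m)
allPoints zero = [] ∷ []
allPoints (suc m) = concatMap (λ v → (false ∷ v) ∷ (true ∷ v) ∷ []) (allPoints m)

allTuples : (k m : ℕ) → List (Tuple k m)
allTuples zero m = [] ∷ []
allTuples (suc k) m =
  concatMap (λ x → map (x ∷_) (allTuples k m)) (allPoints m)

countB : ∀ {A : Set} → (A → Bool) → List A → ℕ
countB p [] = 0
countB p (x ∷ xs) = (if p x then 1 else 0) + countB p xs

countD0 : ∀ {k m} → Rect k m → ℕ
countD0 {k} {m} R = countB (λ xs → inRect R xs ∧ inD0 xs) (allTuples k m)

-- Projection Π_{i,j}(R) ⊆ ({0,1}^{I∖{i}})^k, with I∖{i} identified with Fin n
-- via punchIn i, and (x',b) = insertAt x' i b.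
proj : ∀ {k n} → Fin (suc n) → Fin k → Rect k (suc n) → Rect k n
proj {k} i j R = V.map f (allFin k)
  where
  f : Fin k → Subset _
  f j' x' = if ⌊ j' ≟ j ⌋
              then (lookup R j' (insertAt x' i false) ∨ lookup R j' (insertAt x' i true))
              else lookup R j' (insertAt x' i false)

-- With E = log₂(a/(k+1)^m) and E' = log₂(a'/(k+1)^m')
-- (log₂ 0 = -∞), the inequality  E' ≥ E + 1/k  (k ≥ 1) is equivalent to
--   2 · a^k · (k+1)^(k·m') ≤ a'^k · (k+1)^(k·m),
-- including the -∞ cases (a = 0: both sides true; a' = 0 < a: both false).
DensityGeqPlus1/k : (k a' m' a m : ℕ) → Set
DensityGeqPlus1/k k a' m' a m =
  2 * (a ^ k) * ((suc k) ^ (k * m')) ≤ (a' ^ k) * ((suc k) ^ (k * m))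

{-# OPTIONS --safe #-}
-- Fix the entries ys of a tuple outside coordinate i. Completing ys to a tuple
-- of D₀ means writing into column i either only zeros or a single one, in some
-- row j; if that completion lies in R, then ys lies in Π_{i,j}(R), and for the
-- all-zero column ys lies in every Π_{i,j}(R). So over each ys ∈ D₀ the
-- completions in R ∩ D₀ are at most as many as the j with ys ∈ Π_{i,j}(R): a
-- surplus needs the all-zero column and every one-row completion in R, and
-- then, R being a rectangle, the all-ones column lies in R ∩ Dᵢ. Summing over
-- ys gives |R ∩ D₀| ≤ Σ_j |Π_{i,j}(R) ∩ D₀|, so some j has
-- k |Π_{i,j}(R) ∩ D₀| ≥ |R ∩ D₀|, and the density gain of 1/k follows from
-- (1 + 1/k)^k ≥ 2.
module Submission where

open import Algebra.Bundles using (CommutativeMonoid)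
import Algebra.Properties.CommutativeSemigroup as CommSemigroupProperties
open import Data.Bool using (Bool; true; false; if_then_else_; _∧_; _∨_)
open import Data.Bool.Properties using (∧-zeroʳ; ∧-comm; ∧-commutativeMonoid)
open import Data.Empty using (⊥; ⊥-elim)
open import Data.Fin using (Fin; zero; suc; punchIn)
open import Data.Fin.Properties using (_≟_; punchInᵢ≢i)
open import Data.List using (List; []; _∷_; _++_; map; concatMap; length; allFin)
open import Data.List.Extrema.Nat using (argmax; f[xs]≤f[argmax])
open import Data.List.Properties using (map-cong; map-++; map-∘; map-tabulate; length-tabulate)
open import Data.List.Relation.Unary.All using (All; []; _∷_)
open import Data.Nat using (ℕ; zero; suc; _+_; _*_; _^_; _≤_; _≤ᵇ_; _<ᵇ_; z≤n; s≤s; NonZero)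
import Data.Nat as ℕ
open import Data.Nat.ListAction using (sum)
open import Data.Nat.ListAction.Properties using (sum-++)
open import Data.Nat.Properties
  using ( +-identityʳ; *-identityʳ; +-comm; +-assoc; +-mono-≤; +-monoʳ-≤; *-monoˡ-≤; *-monoʳ-≤
        ; ^-monoˡ-≤; ^-distribˡ-+-*; *-suc; *-cancelˡ-≤; m≤m+n; ≤-refl; ≤-reflexive; ≤-trans
        ; module ≤-Reasoning; +-commutativeSemigroup; *-commutativeSemigroup )
open import Data.Nat.Tactic.RingSolver using (solve-∀)
open import Data.Product using (∃; _,_)
open import Data.Vec using (Vec; []; _∷_; lookup; insertAt; replicate; zipWith)
import Data.Vec as V
open import Data.Vec.Properties
  using (lookup-map; lookup-allFin; lookup-replicate; insertAt-lookup; insertAt-punchIn)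
import Data.Vec.Functional as VF
open import Function using (id; _∘_)
open import Relation.Binary.PropositionalEquality
  using (_≡_; refl; sym; trans; cong; cong₂; cong-app; module ≡-Reasoning)
open import Relation.Nullary.Decidable using (⌊_⌋; does; isYes≗does; dec-true; dec-false)

open import Defs

private
  module +-Props = CommSemigroupProperties +-commutativeSemigroup
  module *-Props = CommSemigroupProperties *-commutativeSemigroup
  module ∧-Props = CommSemigroupProperties (CommutativeMonoid.commutativeSemigroup ∧-commutativeMonoid)

private
  variable
    A B : Set
    k m n : ℕ

-- Definitionally the indicator written inline in `countB` and `colSum`.
𝟙 : Bool → ℕ
𝟙 b = if b then 1 else 0

+-𝟙-∧-false : ∀ n x {y} → y ≡ false → n + 𝟙 (x ∧ y) ≡ n
+-𝟙-∧-false n x refl = trans (cong (λ b → n + 𝟙 b) (∧-zeroʳ x)) (+-identityʳ n)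

𝟙-∧-≤ : ∀ x y → 𝟙 (x ∧ y) ≤ 𝟙 x
𝟙-∧-≤ false y = z≤n
𝟙-∧-≤ true false = z≤n
𝟙-∧-≤ true true = ≤-refl

∑ : List A → (A → ℕ) → ℕ
∑ xs f = sum (map f xs)

infixr 10 ∑
syntax ∑ xs (λ x → e) = ∑[ x ∈ xs ] e

∑-cong : ∀ (xs : List A) {f g : A → ℕ} → (∀ x → f x ≡ g x) → ∑ xs f ≡ ∑ xs g
∑-cong xs f≗g = cong sum (map-cong f≗g xs)

∑-mono-≤ : ∀ (xs : List A) {f g : A → ℕ} → (∀ x → f x ≤ g x) → ∑ xs f ≤ ∑ xs g
∑-mono-≤ [] f≤g = z≤n
∑-mono-≤ (x ∷ xs) f≤g = +-mono-≤ (f≤g x) (∑-mono-≤ xs f≤g)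

∑-zero : ∀ (xs : List A) → ∑[ x ∈ xs ] 0 ≡ 0
∑-zero [] = refl
∑-zero (x ∷ xs) = ∑-zero xs

∑-distrib-+ : ∀ (xs : List A) (f g : A → ℕ) → ∑[ x ∈ xs ] (f x + g x) ≡ ∑ xs f + ∑ xs g
∑-distrib-+ [] f g = refl
∑-distrib-+ (x ∷ xs) f g =
  trans (cong (f x + g x +_) (∑-distrib-+ xs f g)) (+-Props.interchange (f x) (g x) _ _)

∑-map : ∀ (h : A → B) (xs : List A) (f : B → ℕ) → ∑ (map h xs) f ≡ ∑ xs (f ∘ h)
∑-map h xs f = cong sum (sym (map-∘ xs))

∑-concatMap : ∀ (g : A → List B) (xs : List A) (f : B → ℕ) →
              ∑ (concatMap g xs) f ≡ ∑[ x ∈ xs ] ∑ (g x) f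
∑-concatMap g [] f = refl
∑-concatMap g (x ∷ xs) f = begin
  sum (map f (g x ++ concatMap g xs))          ≡⟨ cong sum (map-++ f (g x) _) ⟩
  sum (map f (g x) ++ map f (concatMap g xs))  ≡⟨ sum-++ (map f (g x)) _ ⟩
  ∑ (g x) f + ∑ (concatMap g xs) f             ≡⟨ cong (∑ (g x) f +_) (∑-concatMap g xs f) ⟩
  ∑ (g x) f + ∑[ x′ ∈ xs ] ∑ (g x′) f          ∎
  where open ≡-Reasoning

∑-comm : ∀ (xs : List A) (ys : List B) (f : A → B → ℕ) →
         ∑[ x ∈ xs ] ∑ ys (f x) ≡ ∑[ y ∈ ys ] ∑[ x ∈ xs ] f x y
∑-comm [] ys f = sym (∑-zero ys)
∑-comm (x ∷ xs) ys f =
  trans (cong (∑ ys (f x) +_) (∑-comm xs ys f)) (sym (∑-distrib-+ ys (f x) _))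

∑-≤-length* : ∀ {xs : List A} {f : A → ℕ} {c} → All (λ x → f x ≤ c) xs → ∑ xs f ≤ length xs * c
∑-≤-length* [] = z≤n
∑-≤-length* (fx≤c ∷ fxs≤c) = +-mono-≤ fx≤c (∑-≤-length* fxs≤c)

∑-allFin-suc : ∀ (f : Fin (suc k) → ℕ) → ∑ (allFin (suc k)) f ≡ f zero + ∑ (allFin k) (f ∘ suc)
∑-allFin-suc f =
  cong (f zero +_) (cong sum (trans (map-tabulate suc f) (sym (map-tabulate id (f ∘ suc)))))

countB-∑ : ∀ (p : A → Bool) xs → countB p xs ≡ ∑[ x ∈ xs ] 𝟙 (p x)
countB-∑ p [] = refl
countB-∑ p (x ∷ xs) = cong (𝟙 (p x) +_) (countB-∑ p xs)

∑-allPoints-suc : ∀ n (f : Point (suc n) → ℕ) →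
                  ∑ (allPoints (suc n)) f ≡ ∑[ v ∈ allPoints n ] (f (false ∷ v) + f (true ∷ v))
∑-allPoints-suc n f =
  trans (∑-concatMap _ (allPoints n) f)
        (∑-cong (allPoints n) (λ v → cong (f (false ∷ v) +_) (+-identityʳ _)))

∑-allPoints-insertAt : ∀ n (i : Fin (suc n)) (f : Point (suc n) → ℕ) →
  ∑ (allPoints (suc n)) f ≡ ∑[ v ∈ allPoints n ] (f (insertAt v i false) + f (insertAt v i true))
∑-allPoints-insertAt n zero f = ∑-allPoints-suc n f
∑-allPoints-insertAt (suc n) (suc i) f = begin
  ∑ (allPoints (suc (suc n))) f
    ≡⟨ ∑-allPoints-suc (suc n) f ⟩
  ∑[ v ∈ allPoints (suc n) ] (f (false ∷ v) + f (true ∷ v))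
    ≡⟨ ∑-allPoints-insertAt n i _ ⟩
  ∑[ w ∈ allPoints n ] ((f (false ∷ insertAt w i false) + f (true ∷ insertAt w i false))
                      + (f (false ∷ insertAt w i true) + f (true ∷ insertAt w i true)))
    ≡⟨ ∑-cong (allPoints n) (λ w → +-Props.interchange (f (false ∷ insertAt w i false))
                                                        (f (true ∷ insertAt w i false)) _ _) ⟩
  ∑[ w ∈ allPoints n ] ((f (false ∷ insertAt w i false) + f (false ∷ insertAt w i true))
                      + (f (true ∷ insertAt w i false) + f (true ∷ insertAt w i true)))
    ≡⟨ ∑-allPoints-suc n _ ⟨
  ∑[ v ∈ allPoints (suc n) ] (f (insertAt v (suc i) false) + f (insertAt v (suc i) true))
    ∎
  where open ≡-Reasoning

∑-allTuples-suc : ∀ k m (f : Tuple (suc k) m → ℕ) →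
                  ∑ (allTuples (suc k) m) f ≡ ∑[ x ∈ allPoints m ] ∑[ xs ∈ allTuples k m ] f (x ∷ xs)
∑-allTuples-suc k m f =
  trans (∑-concatMap _ (allPoints m) f) (∑-cong (allPoints m) (λ x → ∑-map (x ∷_) (allTuples k m) f))

insertColumn : Fin (suc n) → Tuple k n → Vec Bool k → Tuple k (suc n)
insertColumn i = zipWith (λ y b → insertAt y i b)

∑-allTuples-insertColumn : ∀ k n (i : Fin (suc n)) (f : Tuple k (suc n) → ℕ) →
  ∑ (allTuples k (suc n)) f ≡ ∑[ ys ∈ allTuples k n ] ∑[ bs ∈ allPoints k ] f (insertColumn i ys bs)
∑-allTuples-insertColumn zero n i f = sym (+-identityʳ _)
∑-allTuples-insertColumn (suc k) n i f = begin
  ∑ (allTuples (suc k) (suc n)) f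
    ≡⟨ ∑-allTuples-suc k (suc n) f ⟩
  ∑[ x ∈ allPoints (suc n) ] ∑[ xs ∈ allTuples k (suc n) ] f (x ∷ xs)
    ≡⟨ ∑-cong (allPoints (suc n)) (λ x → ∑-allTuples-insertColumn k n i (λ xs → f (x ∷ xs))) ⟩
  ∑[ x ∈ allPoints (suc n) ] S x
    ≡⟨ ∑-allPoints-insertAt n i S ⟩
  ∑[ y ∈ allPoints n ] (S (insertAt y i false) + S (insertAt y i true))
    ≡⟨ ∑-cong (allPoints n) split ⟨
  ∑[ y ∈ allPoints n ] ∑[ ys ∈ allTuples k n ] ∑[ bs ∈ allPoints (suc k) ] f (insertColumn i (y ∷ ys) bs)
    ≡⟨ ∑-allTuples-suc k n _ ⟨
  ∑[ ys ∈ allTuples (suc k) n ] ∑[ bs ∈ allPoints (suc k) ] f (insertColumn i ys bs)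
    ∎
  where
  open ≡-Reasoning
  S : Point (suc n) → ℕ
  S x = ∑[ ys ∈ allTuples k n ] ∑[ bs ∈ allPoints k ] f (x ∷ insertColumn i ys bs)
  split : ∀ y → ∑[ ys ∈ allTuples k n ] ∑[ bs ∈ allPoints (suc k) ] f (insertColumn i (y ∷ ys) bs)
              ≡ S (insertAt y i false) + S (insertAt y i true)
  split y = trans (∑-cong (allTuples k n) (λ ys → trans (∑-allPoints-suc k _)
                                                        (∑-distrib-+ (allPoints k) _ _)))
                  (∑-distrib-+ (allTuples k n) _ _)

-- Unlike `allB`, unfolds definitionally at `suc k`.
⋀ : (Fin k → Bool) → Bool
⋀ = VF.foldr _∧_ true

⋀-cong : ∀ {p q : Fin k → Bool} → (∀ c → p c ≡ q c) → ⋀ p ≡ ⋀ q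
⋀-cong {zero} p≗q = refl
⋀-cong {suc k} p≗q = cong₂ _∧_ (p≗q zero) (⋀-cong (p≗q ∘ suc))

⋀-punchIn : ∀ (i : Fin (suc n)) (p : Fin (suc n) → Bool) → ⋀ p ≡ p i ∧ ⋀ (p ∘ punchIn i)
⋀-punchIn zero p = refl
⋀-punchIn {suc n} (suc i) p =
  trans (cong (p zero ∧_) (⋀-punchIn i (p ∘ suc))) (∧-Props.x∙yz≈y∙xz (p zero) (p (suc i)) _)

allB≡⋀ : ∀ (p : Fin m → Bool) → allB p ≡ ⋀ p
allB≡⋀ {m} p = foldr-tabulate id
  where
  foldr-tabulate : ∀ {m′} (h : Fin m′ → Fin m) →
                   V.foldr _ (λ c b → p c ∧ b) true (V.tabulate h) ≡ ⋀ (p ∘ h)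
  foldr-tabulate {zero} h = refl
  foldr-tabulate {suc m′} h = cong (p (h zero) ∧_) (foldr-tabulate (h ∘ suc))

weight : Vec Bool k → ℕ
weight bs = V.sum (V.map 𝟙 bs)

weight-replicate : ∀ k → weight (replicate k true) ≡ k
weight-replicate zero = refl
weight-replicate (suc k) = cong suc (weight-replicate k)

colSum-insertColumn-at : ∀ (i : Fin (suc n)) (ys : Tuple k n) bs →
                         colSum (insertColumn i ys bs) i ≡ weight bs
colSum-insertColumn-at i [] [] = refl
colSum-insertColumn-at i (y ∷ ys) (b ∷ bs) =
  cong₂ _+_ (cong 𝟙 (insertAt-lookup y i b)) (colSum-insertColumn-at i ys bs)

colSum-insertColumn-punchIn : ∀ (i : Fin (suc n)) (ys : Tuple k n) bs c →
                              colSum (insertColumn i ys bs) (punchIn i c) ≡ colSum ys c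
colSum-insertColumn-punchIn i [] [] c = refl
colSum-insertColumn-punchIn i (y ∷ ys) (b ∷ bs) c =
  cong₂ _+_ (cong 𝟙 (insertAt-punchIn y i b c)) (colSum-insertColumn-punchIn i ys bs c)

inD0-insertColumn : ∀ (i : Fin (suc n)) (ys : Tuple k n) bs →
                    inD0 (insertColumn i ys bs) ≡ (weight bs ≤ᵇ 1) ∧ inD0 ys
inD0-insertColumn {n = n} {k = k} i ys bs = begin
  inD0 xs
    ≡⟨ allB≡⋀ (λ c → colSum xs c ≤ᵇ 1) ⟩
  ⋀ (λ c → colSum xs c ≤ᵇ 1)
    ≡⟨ ⋀-punchIn i (λ c → colSum xs c ≤ᵇ 1) ⟩
  (colSum xs i ≤ᵇ 1) ∧ ⋀ (λ c → colSum xs (punchIn i c) ≤ᵇ 1)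
    ≡⟨ cong₂ _∧_ (cong (_≤ᵇ 1) (colSum-insertColumn-at i ys bs))
                 (⋀-cong (λ c → cong (_≤ᵇ 1) (colSum-insertColumn-punchIn i ys bs c))) ⟩
  (weight bs ≤ᵇ 1) ∧ ⋀ (λ c → colSum ys c ≤ᵇ 1)
    ≡⟨ cong ((weight bs ≤ᵇ 1) ∧_) (allB≡⋀ (λ c → colSum ys c ≤ᵇ 1)) ⟨
  (weight bs ≤ᵇ 1) ∧ inD0 ys
    ∎
  where
  open ≡-Reasoning
  xs : Tuple k (suc n)
  xs = insertColumn i ys bs

inDi-insertColumn : ∀ (i : Fin (suc n)) (ys : Tuple k n) bs →
                    inDi i (insertColumn i ys bs) ≡ ⌊ weight bs ℕ.≟ k ⌋ ∧ inD0 ys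
inDi-insertColumn {n = n} {k = k} i ys bs = begin
  inDi i xs
    ≡⟨ allB≡⋀ p ⟩
  ⋀ p
    ≡⟨ ⋀-punchIn i p ⟩
  p i ∧ ⋀ (p ∘ punchIn i)
    ≡⟨ cong₂ _∧_ at-i (⋀-cong off-i) ⟩
  ⌊ weight bs ℕ.≟ k ⌋ ∧ ⋀ (λ c → colSum ys c ≤ᵇ 1)
    ≡⟨ cong (⌊ weight bs ℕ.≟ k ⌋ ∧_) (allB≡⋀ (λ c → colSum ys c ≤ᵇ 1)) ⟨
  ⌊ weight bs ℕ.≟ k ⌋ ∧ inD0 ys
    ∎
  where
  open ≡-Reasoning
  xs : Tuple k (suc n)
  xs = insertColumn i ys bs
  p : Fin (suc n) → Bool
  p c = if ⌊ c ≟ i ⌋ then ⌊ colSum xs c ℕ.≟ k ⌋ else (colSum xs c ≤ᵇ 1)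
  at-i : p i ≡ ⌊ weight bs ℕ.≟ k ⌋
  at-i rewrite isYes≗does (i ≟ i) | dec-true (i ≟ i) refl | colSum-insertColumn-at i ys bs = refl
  off-i : ∀ c → p (punchIn i c) ≡ (colSum ys c ≤ᵇ 1)
  off-i c rewrite isYes≗does (punchIn i c ≟ i) | dec-false (punchIn i c ≟ i) (punchInᵢ≢i i c) =
    cong (_≤ᵇ 1) (colSum-insertColumn-punchIn i ys bs c)

-- Over fixed entries ys off coordinate i, R is the product over the rows l of
-- the sets of bits `b` with `fibre R i ys l b`.
fibre : Rect k (suc n) → Fin (suc n) → Tuple k n → Fin k → Bool → Bool
fibre R i ys l b = lookup R l (insertAt (lookup ys l) i b)

inFibre : (Fin k → Bool → Bool) → Vec Bool k → Bool
inFibre F bs = ⋀ (λ l → F l (lookup bs l))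

-- `does` rather than `⌊_⌋`, so that `inProjFibre F (suc j)` unfolds to
-- `F zero false ∧ inProjFibre (F ∘ suc) j`.
inProjFibre : (Fin k → Bool → Bool) → Fin k → Bool
inProjFibre F j = ⋀ (λ l → if does (l ≟ j) then F l false ∨ F l true else F l false)

corner : (Fin k → Bool → Bool) → Bool → Bool
corner F b = ⋀ (λ l → F l b)

inFibre-replicate : ∀ (F : Fin k → Bool → Bool) b → inFibre F (replicate k b) ≡ corner F b
inFibre-replicate F b = ⋀-cong (λ l → cong (F l) (lookup-replicate l b))

inRect-insertColumn : ∀ (R : Rect k (suc n)) i ys bs →
                      inRect R (insertColumn i ys bs) ≡ inFibre (fibre R i ys) bs
inRect-insertColumn [] i [] [] = refl
inRect-insertColumn (X ∷ R) i (y ∷ ys) (b ∷ bs) =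
  cong (X (insertAt y i b) ∧_) (inRect-insertColumn R i ys bs)

inRect≡⋀ : ∀ (R : Rect k m) xs → inRect R xs ≡ ⋀ (λ l → lookup R l (lookup xs l))
inRect≡⋀ [] [] = refl
inRect≡⋀ (X ∷ R) (x ∷ xs) = cong (X x ∧_) (inRect≡⋀ R xs)

inRect-proj : ∀ (R : Rect k (suc n)) i j ys → inRect (proj i j R) ys ≡ inProjFibre (fibre R i ys) j
inRect-proj {k = k} {n = n} R i j ys = trans (inRect≡⋀ (proj i j R) ys) (⋀-cong lookup-proj)
  where
  column : Fin k → Point n → Bool
  column l x = if ⌊ l ≟ j ⌋ then lookup R l (insertAt x i false) ∨ lookup R l (insertAt x i true)
                            else lookup R l (insertAt x i false)
  lookup-proj : ∀ l → lookup (proj i j R) l (lookup ys l)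
                     ≡ (if does (l ≟ j) then fibre R i ys l false ∨ fibre R i ys l true
                                         else fibre R i ys l false)
  lookup-proj l =
    trans (cong-app (trans (lookup-map l column (V.allFin k)) (cong column (lookup-allFin l))) (lookup ys l))
          (cong (λ t → if t then _ else _) (isYes≗does (l ≟ j)))

-- Phrased with `<ᵇ` because `weight (true ∷ bs) ≤ᵇ 1` reduces to `weight bs <ᵇ 1`.
∑-inFibre-weight<1 : ∀ (F : Fin k → Bool → Bool) →
                     ∑[ bs ∈ allPoints k ] 𝟙 (inFibre F bs ∧ (weight bs <ᵇ 1)) ≡ 𝟙 (corner F false)
∑-inFibre-weight<1 {zero} F = refl
∑-inFibre-weight<1 {suc k} F = begin
  ∑[ bs ∈ allPoints (suc k) ] 𝟙 (inFibre F bs ∧ (weight bs <ᵇ 1))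
    ≡⟨ ∑-allPoints-suc k _ ⟩
  ∑[ bs ∈ allPoints k ] (𝟙 ((F zero false ∧ inFibre G bs) ∧ (weight bs <ᵇ 1))
                         + 𝟙 ((F zero true ∧ inFibre G bs) ∧ false))
    ≡⟨ ∑-cong (allPoints k) (λ bs → +-𝟙-∧-false _ (F zero true ∧ inFibre G bs) refl) ⟩
  ∑[ bs ∈ allPoints k ] 𝟙 ((F zero false ∧ inFibre G bs) ∧ (weight bs <ᵇ 1))
    ≡⟨ first-bit (F zero false) ⟩
  𝟙 (F zero false ∧ corner G false)
    ∎
  where
  open ≡-Reasoning
  G : Fin k → Bool → Bool
  G = F ∘ suc
  first-bit : ∀ a → ∑[ bs ∈ allPoints k ] 𝟙 ((a ∧ inFibre G bs) ∧ (weight bs <ᵇ 1))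
                  ≡ 𝟙 (a ∧ corner G false)
  first-bit false = ∑-zero (allPoints k)
  first-bit true = ∑-inFibre-weight<1 G

∑-inFibre-weight≤1 : ∀ (F : Fin k → Bool → Bool) →
  ∑[ bs ∈ allPoints k ] 𝟙 (inFibre F bs ∧ (weight bs ≤ᵇ 1))
    ≤ ∑[ j ∈ allFin k ] 𝟙 (inProjFibre F j) + 𝟙 (corner F false ∧ corner F true)
∑-inFibre-weight≤1 {zero} F = ≤-refl
∑-inFibre-weight≤1 {suc k} F = begin
  ∑[ bs ∈ allPoints (suc k) ] 𝟙 (inFibre F bs ∧ (weight bs ≤ᵇ 1))
    ≡⟨ trans (∑-allPoints-suc k _) (∑-distrib-+ (allPoints k) _ _) ⟩
  ∑[ bs ∈ allPoints k ] 𝟙 ((F zero false ∧ inFibre G bs) ∧ (weight bs ≤ᵇ 1))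
    + ∑[ bs ∈ allPoints k ] 𝟙 ((F zero true ∧ inFibre G bs) ∧ (weight bs <ᵇ 1))
    ≤⟨ first-bit (F zero false) (F zero true) ⟩
  𝟙 ((F zero false ∨ F zero true) ∧ corner G false)
    + ∑[ j ∈ allFin k ] 𝟙 (F zero false ∧ inProjFibre G j)
    + 𝟙 ((F zero false ∧ corner G false) ∧ (F zero true ∧ corner G true))
    ≡⟨ cong (_+ 𝟙 (corner F false ∧ corner F true)) (∑-allFin-suc (𝟙 ∘ inProjFibre F)) ⟨
  ∑[ j ∈ allFin (suc k) ] 𝟙 (inProjFibre F j) + 𝟙 (corner F false ∧ corner F true)
    ∎
  where
  open ≤-Reasoning
  G : Fin k → Bool → Bool
  G = F ∘ suc
  L Z P : ℕ
  L = ∑[ bs ∈ allPoints k ] 𝟙 (inFibre G bs ∧ (weight bs ≤ᵇ 1))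
  Z = 𝟙 (corner G false)
  P = ∑[ j ∈ allFin k ] 𝟙 (inProjFibre G j)
  first-bit : ∀ a b →
    ∑[ bs ∈ allPoints k ] 𝟙 ((a ∧ inFibre G bs) ∧ (weight bs ≤ᵇ 1))
      + ∑[ bs ∈ allPoints k ] 𝟙 ((b ∧ inFibre G bs) ∧ (weight bs <ᵇ 1))
      ≤ 𝟙 ((a ∨ b) ∧ corner G false) + ∑[ j ∈ allFin k ] 𝟙 (a ∧ inProjFibre G j)
        + 𝟙 ((a ∧ corner G false) ∧ (b ∧ corner G true))
  first-bit true true = begin
    L + ∑[ bs ∈ allPoints k ] 𝟙 (inFibre G bs ∧ (weight bs <ᵇ 1))
      ≤⟨ +-mono-≤ (∑-inFibre-weight≤1 G) (≤-reflexive (∑-inFibre-weight<1 G)) ⟩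
    P + 𝟙 (corner G false ∧ corner G true) + Z
      ≡⟨ trans (+-comm _ Z) (sym (+-assoc Z P _)) ⟩
    Z + P + 𝟙 (corner G false ∧ corner G true)
      ∎
  first-bit true false = begin
    L + ∑[ bs ∈ allPoints k ] 0
      ≡⟨ trans (cong (L +_) (∑-zero (allPoints k))) (+-identityʳ L) ⟩
    L
      ≤⟨ ∑-inFibre-weight≤1 G ⟩
    P + 𝟙 (corner G false ∧ corner G true)
      ≤⟨ +-monoʳ-≤ P (𝟙-∧-≤ (corner G false) (corner G true)) ⟩
    P + Z
      ≡⟨ +-comm P Z ⟩
    Z + P
      ≡⟨ +-𝟙-∧-false (Z + P) (corner G false) refl ⟨
    Z + P + 𝟙 (corner G false ∧ false)
      ∎
  first-bit false true = begin
    ∑[ bs ∈ allPoints k ] 0 + ∑[ bs ∈ allPoints k ] 𝟙 (inFibre G bs ∧ (weight bs <ᵇ 1))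
      ≡⟨ cong₂ _+_ (∑-zero (allPoints k)) (∑-inFibre-weight<1 G) ⟩
    Z
      ≤⟨ m≤m+n Z _ ⟩
    Z + ∑[ j ∈ allFin k ] 0
      ≤⟨ m≤m+n _ 0 ⟩
    Z + ∑[ j ∈ allFin k ] 0 + 0
      ∎
  first-bit false false =
    ≤-trans (≤-reflexive (cong₂ _+_ (∑-zero (allPoints k)) (∑-zero (allPoints k)))) z≤n

DisjointFromDᵢ : Rect k (suc n) → Fin (suc n) → Set
DisjointFromDᵢ R i = ∀ xs → inRect R xs ≡ true → inDi i xs ≡ true → ⊥

module _ (R : Rect k (suc n)) (i : Fin (suc n)) (R∩Dᵢ≡∅ : DisjointFromDᵢ R i) where

  corner-true≡false : ∀ ys → inD0 ys ≡ true → corner (fibre R i ys) true ≡ false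
  corner-true≡false ys ys∈D₀ with corner (fibre R i ys) true in corner≡true
  ... | false = refl
  ... | true = ⊥-elim (R∩Dᵢ≡∅ (insertColumn i ys (replicate k true)) in-R in-Dᵢ)
    where
    in-R : inRect R (insertColumn i ys (replicate k true)) ≡ true
    in-R = trans (inRect-insertColumn R i ys _)
                 (trans (inFibre-replicate (fibre R i ys) true) corner≡true)
    in-Dᵢ : inDi i (insertColumn i ys (replicate k true)) ≡ true
    in-Dᵢ rewrite inDi-insertColumn i ys (replicate k true) | weight-replicate k
                | isYes≗does (k ℕ.≟ k) | dec-true (k ℕ.≟ k) refl = ys∈D₀

  fibre-count-≤ : ∀ ys →
    ∑[ bs ∈ allPoints k ] 𝟙 (inRect R (insertColumn i ys bs) ∧ inD0 (insertColumn i ys bs))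
      ≤ ∑[ j ∈ allFin k ] 𝟙 (inRect (proj i j R) ys ∧ inD0 ys)
  fibre-count-≤ ys = begin
    ∑[ bs ∈ allPoints k ] 𝟙 (inRect R (insertColumn i ys bs) ∧ inD0 (insertColumn i ys bs))
      ≡⟨ ∑-cong (allPoints k) (cong 𝟙 ∘ point-eq) ⟩
    ∑[ bs ∈ allPoints k ] 𝟙 (inD0 ys ∧ (inFibre F bs ∧ (weight bs ≤ᵇ 1)))
      ≤⟨ case-inD0 (inD0 ys) refl ⟩
    ∑[ j ∈ allFin k ] 𝟙 (inD0 ys ∧ inProjFibre F j)
      ≡⟨ ∑-cong (allFin k) (cong 𝟙 ∘ proj-eq) ⟨
    ∑[ j ∈ allFin k ] 𝟙 (inRect (proj i j R) ys ∧ inD0 ys)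
      ∎
    where
    open ≤-Reasoning
    F : Fin k → Bool → Bool
    F = fibre R i ys
    point-eq : ∀ bs → inRect R (insertColumn i ys bs) ∧ inD0 (insertColumn i ys bs)
                    ≡ inD0 ys ∧ (inFibre F bs ∧ (weight bs ≤ᵇ 1))
    point-eq bs = trans (cong₂ _∧_ (inRect-insertColumn R i ys bs) (inD0-insertColumn i ys bs))
                        (∧-Props.x∙yz≈z∙xy (inFibre F bs) (weight bs ≤ᵇ 1) (inD0 ys))
    proj-eq : ∀ j → inRect (proj i j R) ys ∧ inD0 ys ≡ inD0 ys ∧ inProjFibre F j
    proj-eq j = trans (cong (_∧ inD0 ys) (inRect-proj R i j ys)) (∧-comm (inProjFibre F j) (inD0 ys))
    case-inD0 : ∀ d → inD0 ys ≡ d →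
      ∑[ bs ∈ allPoints k ] 𝟙 (d ∧ (inFibre F bs ∧ (weight bs ≤ᵇ 1)))
        ≤ ∑[ j ∈ allFin k ] 𝟙 (d ∧ inProjFibre F j)
    case-inD0 false _ = ≤-trans (≤-reflexive (∑-zero (allPoints k))) z≤n
    case-inD0 true ys∈D₀ = begin
      ∑[ bs ∈ allPoints k ] 𝟙 (inFibre F bs ∧ (weight bs ≤ᵇ 1))
        ≤⟨ ∑-inFibre-weight≤1 F ⟩
      ∑[ j ∈ allFin k ] 𝟙 (inProjFibre F j) + 𝟙 (corner F false ∧ corner F true)
        ≡⟨ +-𝟙-∧-false _ (corner F false) (corner-true≡false ys ys∈D₀) ⟩
      ∑[ j ∈ allFin k ] 𝟙 (inProjFibre F j)
        ∎

  countD0-≤-∑-countD0-proj : countD0 R ≤ ∑[ j ∈ allFin k ] countD0 (proj i j R)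
  countD0-≤-∑-countD0-proj = begin
    countD0 R
      ≡⟨ countB-∑ _ (allTuples k (suc n)) ⟩
    ∑[ xs ∈ allTuples k (suc n) ] 𝟙 (inRect R xs ∧ inD0 xs)
      ≡⟨ ∑-allTuples-insertColumn k n i _ ⟩
    ∑[ ys ∈ allTuples k n ] ∑[ bs ∈ allPoints k ]
      𝟙 (inRect R (insertColumn i ys bs) ∧ inD0 (insertColumn i ys bs))
      ≤⟨ ∑-mono-≤ (allTuples k n) fibre-count-≤ ⟩
    ∑[ ys ∈ allTuples k n ] ∑[ j ∈ allFin k ] 𝟙 (inRect (proj i j R) ys ∧ inD0 ys)
      ≡⟨ ∑-comm (allTuples k n) (allFin k) _ ⟩
    ∑[ j ∈ allFin k ] ∑[ ys ∈ allTuples k n ] 𝟙 (inRect (proj i j R) ys ∧ inD0 ys)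
      ≡⟨ ∑-cong (allFin k) (λ j → countB-∑ _ (allTuples k n)) ⟨
    ∑[ j ∈ allFin k ] countD0 (proj i j R)
      ∎
    where open ≤-Reasoning

^-distrib-* : ∀ m n o → (m * n) ^ o ≡ m ^ o * n ^ o
^-distrib-* m n zero = refl
^-distrib-* m n (suc o) = trans (cong (m * n *_) (^-distrib-* m n o)) (*-Props.interchange m n (m ^ o) (n ^ o))

-- Bernoulli's inequality (1 + 1/k)^m ≥ 1 + m/k, cleared of denominators.
bernoulli : ∀ k m → k ^ m * (k + m) ≤ k * suc k ^ m
bernoulli k zero = ≤-reflexive (trans (+-identityʳ (k + 0)) (trans (+-identityʳ k) (sym (*-identityʳ k))))
bernoulli k (suc m) = begin
  k ^ suc m * (k + suc m)       ≡⟨ lhs k m (k ^ m) ⟩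
  k ^ m * (k * (k + m) + k)     ≤⟨ *-monoʳ-≤ (k ^ m) (m≤m+n _ m) ⟩
  k ^ m * (k * (k + m) + k + m) ≡⟨ mid k m (k ^ m) ⟩
  suc k * (k ^ m * (k + m))     ≤⟨ *-monoʳ-≤ (suc k) (bernoulli k m) ⟩
  suc k * (k * suc k ^ m)       ≡⟨ rhs k (suc k ^ m) ⟩
  k * suc k ^ suc m             ∎
  where
  open ≤-Reasoning
  lhs : ∀ k m p → k * p * (k + suc m) ≡ p * (k * (k + m) + k)
  lhs = solve-∀
  mid : ∀ k m p → p * (k * (k + m) + k + m) ≡ suc k * (p * (k + m))
  mid = solve-∀
  rhs : ∀ k q → suc k * (k * q) ≡ k * (suc k * q)
  rhs = solve-∀

2*k^k≤[1+k]^k : ∀ k .{{_ : NonZero k}} → 2 * k ^ k ≤ suc k ^ k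
2*k^k≤[1+k]^k k = *-cancelˡ-≤ k (≤-trans (≤-reflexive (reorder k (k ^ k))) (bernoulli k k))
  where
  reorder : ∀ k p → k * (2 * p) ≡ p * (k + k)
  reorder = solve-∀

density-gain : ∀ k n {a c} .{{_ : NonZero k}} → a ≤ k * c → DensityGeqPlus1/k k c n a (suc n)
density-gain k n {a} {c} a≤kc = begin
  2 * a ^ k * P                ≤⟨ *-monoˡ-≤ P (*-monoʳ-≤ 2 (^-monoˡ-≤ k a≤kc)) ⟩
  2 * (k * c) ^ k * P          ≡⟨ cong (λ t → 2 * t * P) (^-distrib-* k c k) ⟩
  2 * (k ^ k * c ^ k) * P      ≡⟨ regroup (k ^ k) (c ^ k) P ⟩
  2 * k ^ k * (c ^ k * P)      ≤⟨ *-monoˡ-≤ (c ^ k * P) (2*k^k≤[1+k]^k k) ⟩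
  suc k ^ k * (c ^ k * P)      ≡⟨ *-Props.x∙yz≈y∙xz (suc k ^ k) (c ^ k) P ⟩
  c ^ k * (suc k ^ k * P)      ≡⟨ cong (c ^ k *_) (^-distribˡ-+-* (suc k) k (k * n)) ⟨
  c ^ k * suc k ^ (k + k * n)  ≡⟨ cong (λ e → c ^ k * suc k ^ e) (*-suc k n) ⟨
  c ^ k * suc k ^ (k * suc n)  ∎
  where
  open ≤-Reasoning
  P : ℕ
  P = suc k ^ (k * n)
  regroup : ∀ x y p → 2 * (x * y) * p ≡ 2 * x * (y * p)
  regroup = solve-∀

lemma3p5 : (k n : ℕ) → 2 ≤ k → (R : Rect k (suc n)) → (i : Fin (suc n))
    → ((xs : Tuple k (suc n)) → inRect R xs ≡ true → inDi i xs ≡ true → ⊥)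
    → ∃ λ (j : Fin k) → DensityGeqPlus1/k k (countD0 (proj i j R)) n (countD0 R) (suc n)
lemma3p5 (suc k) n (s≤s _) R i R∩Dᵢ≡∅ = j , density-gain (suc k) n count≤
  where
  open ≤-Reasoning
  h : Fin (suc k) → ℕ
  h j = countD0 (proj i j R)
  j : Fin (suc k)
  j = argmax h zero (allFin (suc k))
  count≤ : countD0 R ≤ suc k * h j
  count≤ = begin
    countD0 R                       ≤⟨ countD0-≤-∑-countD0-proj R i R∩Dᵢ≡∅ ⟩
    ∑ (allFin (suc k)) h            ≤⟨ ∑-≤-length* (f[xs]≤f[argmax] zero (allFin (suc k))) ⟩
    length (allFin (suc k)) * h j   ≡⟨ cong (_* h j) (length-tabulate {n = suc k} id) ⟩
    suc k * h j                     ∎
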